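{- For every fixed $n\ge1$ and $k\ge1$ there exists a polynomial $P$ such that the following holds. Let $\Phi(x,\mathbf y)$ be a quantifier-free Presburger formula in the integer variables $x\in\mathbb Z$, $\mathbf y\in\mathbb Z^n$, and let $S=\{x\in\mathbb Z:\exists\mathbf y\in\mathbb Z^n\ \Phi(x,\mathbf y)\}$. If $|S|\ge P(\ell(\Phi))$, then $S$ contains a non-trivial $k$-term arithmetic progression.
   Context: A quantifier-free Presburger formula is a Boolean combination (using negation, conjunction, disjunction) of atoms of the form $a_1z_1+\dots+a_mz_m\le b$ with integer constants $a_i,b$ and integer variables $z_i$; its length $\ell(\Phi)$ is the total length of all its symbols and constants written in binary. A non-trivial $k$-term arithmetic progression is a set $\{a,a+d,\dots,a+(k-1)d\}$ of integers with $d\ne0$. -}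

module Defs where

open import Data.Nat as ℕ using (ℕ; zero; suc)
open import Data.Nat.Logarithm using (⌊log₂_⌋)
open import Data.Integer as ℤ using (ℤ; ∣_∣)
open import Data.Vec using (Vec; []; _∷_; zipWith; foldr)
open import Data.List using (List; length)
open import Data.List.Relation.Unary.All using (All)
open import Data.List.Relation.Unary.Unique.Propositional using (Unique)
open import Data.Product using (Σ; ∃; _×_)
open import Data.Sum using (_⊎_)
open import Data.Empty using (⊥)
open import Relation.Binary.PropositionalEquality using (_≡_)
open import Relation.Nullary using (¬_)

-- Quantifier-free Presburger formulas over m integer variables z₀,…,z_{m-1}.
-- Atom  (atom a b)  is  a₀z₀ + … + a_{m-1}z_{m-1} ≤ b.
data Formula (m : ℕ) : Set where
  atom : Vec ℤ m → ℤ → Formula m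
  neg  : Formula m → Formula m
  conj : Formula m → Formula m → Formula m
  disj : Formula m → Formula m → Formula m

dot : ∀ {m} → Vec ℤ m → Vec ℤ m → ℤ
dot a z = foldr (λ _ → ℤ) ℤ._+_ (ℤ.+ 0) (zipWith ℤ._*_ a z)

⟦_⟧ : ∀ {m} → Formula m → Vec ℤ m → Set
⟦ atom a b ⟧ z = dot a z ℤ.≤ b
⟦ neg φ ⟧ z = ¬ ⟦ φ ⟧ z
⟦ conj φ ψ ⟧ z = ⟦ φ ⟧ z × ⟦ ψ ⟧ z
⟦ disj φ ψ ⟧ z = ⟦ φ ⟧ z ⊎ ⟦ ψ ⟧ z

-- Number of binary digits of a natural number (0 is written "0", one digit).
bitLength : ℕ → ℕ
bitLength zero = 1
bitLength (suc k) = suc ⌊log₂ (suc k) ⌋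

-- Length of an integer constant in binary: sign symbol + digits.
ℤlength : ℤ → ℕ
ℤlength a = suc (bitLength ∣ a ∣)

-- Atom: each coefficient aᵢ costs its binary length plus one symbol
-- (for the variable / '+'), plus the length of b and one symbol for '≤'.
ℓ : ∀ {m} → Formula m → ℕ
ℓ (atom a b) = foldr (λ _ → ℕ) (λ c r → suc (ℤlength c) ℕ.+ r) 0 a ℕ.+ suc (ℤlength b)
ℓ (neg φ) = suc (ℓ φ)
ℓ (conj φ ψ) = suc (ℓ φ ℕ.+ ℓ ψ)
ℓ (disj φ ψ) = suc (ℓ φ ℕ.+ ℓ ψ)

InS : ∀ {n} → Formula (suc n) → ℤ → Set
InS {n} Φ x = Σ (Vec ℤ n) λ y → ⟦ Φ ⟧ (x ∷ y)

-- Polynomials with natural-number coefficients, c₀ + c₁ t + c₂ t² + …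
Poly : Set
Poly = List ℕ

evalPoly : Poly → ℕ → ℕ
evalPoly List.[] t = 0
evalPoly (c List.∷ cs) t = c ℕ.+ t ℕ.* evalPoly cs t

AtLeast : (ℤ → Set) → ℕ → Set
AtLeast S N = Σ (List ℤ) λ xs → Unique xs × All S xs × N ℕ.≤ length xs

HasAP : ℕ → (ℤ → Set) → Set
HasAP k S = Σ ℤ λ a → Σ ℤ λ d → ¬ (d ≡ ℤ.+ 0) ×
  (∀ i → i ℕ.< k → S (a ℤ.+ ℤ.+ i ℤ.* d))

-- Only finitely many sign patterns of the atoms of Φ occur on ℤⁿ⁺¹, and their
-- number is polynomial in the number of atoms: eliminating one variable t, an
-- atom either does not involve t or bounds t from one side, and given the
-- pattern of the t-free parts and of all pairwise comparisons of the bounds,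
-- the pattern at (t, z) is determined by how many upper bounds t satisfies.
-- If S is larger than (number of patterns) · kⁿ⁺¹, two solutions p ≠ q of Φ
-- share their pattern and their residues mod k, so q = p + k r.  Each atom
-- cuts the segment from p to q in a convex set containing both ends, so every
-- p + i r (i < k) has the pattern of p and solves Φ; their first coordinates
-- form the progression.
module Submission where

open import Data.Bool using (Bool; true; false; not; if_then_else_)
open import Data.Fin as Fin using (Fin; combine; fromℕ<)
import Data.Fin.Properties as Finₚ
open import Data.Integer
  using (ℤ; +_; -[1+_]; +[1+_]; _+_; _*_; _-_; -_; _≤_; _<_; _≤?_)
open import Data.Integer.DivMod using (_%ℕ_; _/ℕ_; n%ℕd<d; a≡a%ℕn+[a/ℕn]*n)
import Data.Integer.Properties as ℤₚ
open import Data.Integer.Tactic.RingSolver using (solve-∀)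
open import Data.List as List using (List; []; _∷_; _++_; length; cartesianProductWith)
import Data.List.Properties as Listₚ
open import Data.List.Membership.Propositional using (_∈_)
open import Data.List.Membership.Propositional.Properties
  using (∈-lookup; ∈-cartesianProductWith⁺)
open import Data.List.Relation.Unary.All as All using (All; []; _∷_)
import Data.List.Relation.Unary.All.Properties as Allₚ
open import Data.List.Relation.Unary.AllPairs using (_∷_)
open import Data.List.Relation.Unary.Any using (here; there)
open import Data.List.Relation.Unary.Unique.Propositional using (Unique)
open import Data.Nat as ℕ using (ℕ; zero; suc; s≤s; z≤n; _^_; NonZero)
import Data.Nat.Properties as ℕₚ
import Data.Nat.Tactic.RingSolver as ℕ-Solver
open import Data.Product using (Σ; _×_; _,_; proj₁; proj₂)
open import Data.Sum as Sum using (_⊎_; inj₁; inj₂)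
open import Data.Vec as Vec using (Vec; []; _∷_)
open import Relation.Binary.PropositionalEquality
open import Relation.Nullary using (¬_; Dec; yes; no; does; contradiction)
open import Relation.Nullary.Decidable using (dec-true; dec-false)

open import Defs

does-true⁻ : ∀ {P : Set} (P? : Dec P) → does P? ≡ true → P
does-true⁻ (yes p) _ = p
does-true⁻ (no _) ()

does-false⁻ : ∀ {P : Set} (P? : Dec P) → does P? ≡ false → ¬ P
does-false⁻ (no ¬p) _ = ¬p
does-false⁻ (yes _) ()

-- Linear arithmetic by certificate: each use below exhibits the combination as
-- a ring identity.
nonneg-combination≢neg : ∀ (a b c : ℕ) {x₁ y₁ x₂ y₂ x₃ y₃ : ℤ} {n : ℕ} →
  x₁ ≤ y₁ → x₂ ≤ y₂ → x₃ ≤ y₃ →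
  + a * (y₁ - x₁) + + b * (y₂ - x₂) + + c * (y₃ - x₃) ≢ -[1+ n ]
nonneg-combination≢neg a b c h₁ h₂ h₃ eq =
  contradiction (ℤₚ.≤-trans (ℤₚ.+-mono-≤ (ℤₚ.+-mono-≤ (weighted a h₁) (weighted b h₂)) (weighted c h₃))
                            (ℤₚ.≤-reflexive eq))
                λ ()
  where
  weighted : ∀ k {x y} → x ≤ y → + 0 ≤ + k * (y - x)
  weighted k {x} {y} h = subst (_≤ + k * (y - x)) (ℤₚ.*-zeroʳ (+ k)) (ℤₚ.*-monoˡ-≤-nonNeg (+ k) (ℤₚ.i≤j⇒0≤j-i h))

≤?-flip : ∀ x y → does (x ≤? y) ≡ not (does (- x ≤? - y - + 1))
≤?-flip x y with x ≤? y
... | yes x≤y = cong not (sym (dec-false (- x ≤? - y - + 1) λ h →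
      nonneg-combination≢neg 1 1 0 x≤y h (ℤₚ.≤-refl {+ 0}) (certificate x y)))
  where
  certificate : ∀ x y → + 1 * (y - x) + + 1 * ((- y - + 1) - - x) + + 0 * (+ 0 - + 0) ≡ - + 1
  certificate = solve-∀
... | no x≰y = cong not (sym (dec-true (- x ≤? - y - + 1)
      (subst (- x ≤_) (negate y) (ℤₚ.neg-mono-≤ (ℤₚ.i<j⇒suc[i]≤j (ℤₚ.≰⇒> x≰y))))))
  where
  negate : ∀ y → - (+ 1 + y) ≡ - y - + 1
  negate = solve-∀

-- With N = 1 + i + j, N (D + i R) = (1 + j) D + i (D + N R) interpolates
-- between the ends of the segment.
≤-between : ∀ {D R b : ℤ} i j → D ≤ b → D + + suc (i ℕ.+ j) * R ≤ b → D + + i * R ≤ b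
≤-between {D} {R} {b} i j D≤b end≤b = ℤₚ.≮⇒≥ λ b<mid →
  nonneg-combination≢neg (suc j) i (suc (i ℕ.+ j)) D≤b end≤b (ℤₚ.i<j⇒suc[i]≤j b<mid) (certificate (+ i) (+ j) D R b)
  where
  certificate : ∀ I J D R b →
    (+ 1 + J) * (b - D) + I * (b - (D + (+ 1 + I + J) * R))
      + (+ 1 + I + J) * ((D + I * R) - (+ 1 + b)) ≡ - (+ 1 + I + J)
  certificate = solve-∀

>-between : ∀ {D R b : ℤ} i j → b < D → b < D + + suc (i ℕ.+ j) * R → b < D + + i * R
>-between {D} {R} {b} i j b<D b<end = ℤₚ.≰⇒> λ mid≤b →
  nonneg-combination≢neg (suc j) i (suc (i ℕ.+ j)) (ℤₚ.i<j⇒suc[i]≤j b<D) (ℤₚ.i<j⇒suc[i]≤j b<end) mid≤b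
    (certificate (+ i) (+ j) D R b)
  where
  certificate : ∀ I J D R b →
    (+ 1 + J) * (D - (+ 1 + b)) + I * ((D + (+ 1 + I + J) * R) - (+ 1 + b))
      + (+ 1 + I + J) * (b - (D + I * R)) ≡ - (+ 1 + I + J)
  certificate = solve-∀

≤?-between : ∀ (D R b : ℤ) i j →
  does (D ≤? b) ≡ does (D + + suc (i ℕ.+ j) * R ≤? b) → does (D ≤? b) ≡ does (D + + i * R ≤? b)
≤?-between D R b i j ends with D ≤? b
... | yes D≤b = sym (dec-true (_ ≤? b) (≤-between i j D≤b (does-true⁻ (_ ≤? b) (sym ends))))
... | no D≰b = sym (dec-false (_ ≤? b) (ℤₚ.<⇒≱ (>-between i j (ℤₚ.≰⇒> D≰b)
                    (ℤₚ.≰⇒> (does-false⁻ (_ ≤? b) (sym ends))))))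

infixl 6 _+ᵛ_
infixr 7 _·ᵛ_

_+ᵛ_ : ∀ {d} → Vec ℤ d → Vec ℤ d → Vec ℤ d
_+ᵛ_ = Vec.zipWith _+_

_·ᵛ_ : ∀ {d} → ℤ → Vec ℤ d → Vec ℤ d
c ·ᵛ a = Vec.map (c *_) a

dot-·ᵛˡ : ∀ {d} c (a z : Vec ℤ d) → dot (c ·ᵛ a) z ≡ c * dot a z
dot-·ᵛˡ c [] [] = sym (ℤₚ.*-zeroʳ c)
dot-·ᵛˡ c (x ∷ a) (y ∷ z) = trans (cong (λ D → c * x * y + D) (dot-·ᵛˡ c a z)) (factor c x y (dot a z))
  where
  factor : ∀ c x y D → c * x * y + c * D ≡ c * (x * y + D)
  factor = solve-∀

dot-·ᵛʳ : ∀ {d} c (a z : Vec ℤ d) → dot a (c ·ᵛ z) ≡ c * dot a z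
dot-·ᵛʳ c [] [] = sym (ℤₚ.*-zeroʳ c)
dot-·ᵛʳ c (x ∷ a) (y ∷ z) = trans (cong (λ D → x * (c * y) + D) (dot-·ᵛʳ c a z)) (factor c x y (dot a z))
  where
  factor : ∀ c x y D → x * (c * y) + c * D ≡ c * (x * y + D)
  factor = solve-∀

dot-+ᵛˡ : ∀ {d} (a a' z : Vec ℤ d) → dot (a +ᵛ a') z ≡ dot a z + dot a' z
dot-+ᵛˡ [] [] [] = refl
dot-+ᵛˡ (x ∷ a) (x' ∷ a') (y ∷ z) =
  trans (cong (λ D → (x + x') * y + D) (dot-+ᵛˡ a a' z)) (regroup x x' y (dot a z) (dot a' z))
  where
  regroup : ∀ x x' y D D' → (x + x') * y + (D + D') ≡ x * y + D + (x' * y + D')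
  regroup = solve-∀

dot-+ᵛʳ : ∀ {d} (a u v : Vec ℤ d) → dot a (u +ᵛ v) ≡ dot a u + dot a v
dot-+ᵛʳ [] [] [] = refl
dot-+ᵛʳ (x ∷ a) (y ∷ u) (y' ∷ v) =
  trans (cong (λ D → x * (y + y') + D) (dot-+ᵛʳ a u v)) (regroup x y y' (dot a u) (dot a v))
  where
  regroup : ∀ x y y' D D' → x * (y + y') + (D + D') ≡ x * y + D + (x * y' + D')
  regroup = solve-∀

dot-line : ∀ {d} (a p r : Vec ℤ d) c → dot a (p +ᵛ c ·ᵛ r) ≡ dot a p + c * dot a r
dot-line a p r c = trans (dot-+ᵛʳ a p (c ·ᵛ r)) (cong (λ D → dot a p + D) (dot-·ᵛʳ c a r))

Atom : ℕ → Set
Atom d = Vec ℤ d × ℤ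

holds : ∀ {d} → Atom d → Vec ℤ d → Bool
holds (a , b) z = does (dot a z ≤? b)

SamePattern : ∀ {d} → List (Atom d) → Vec ℤ d → Vec ℤ d → Set
SamePattern L z w = All (λ A → holds A z ≡ holds A w) L

samePattern-sym : ∀ {d} {L : List (Atom d)} {z w} → SamePattern L z w → SamePattern L w z
samePattern-sym = All.map sym

atoms : ∀ {m} → Formula m → List (Atom m)
atoms (atom a b) = (a , b) ∷ []
atoms (neg φ) = atoms φ
atoms (conj φ ψ) = atoms φ ++ atoms ψ
atoms (disj φ ψ) = atoms φ ++ atoms ψ

⟦⟧-samePattern : ∀ {m} (Φ : Formula m) {z w} → SamePattern (atoms Φ) z w → ⟦ Φ ⟧ z → ⟦ Φ ⟧ w
⟦⟧-samePattern (atom a b) {z} {w} (same ∷ []) h =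
  does-true⁻ (dot a w ≤? b) (trans (sym same) (dec-true (dot a z ≤? b) h))
⟦⟧-samePattern (neg φ) same ¬φz φw = ¬φz (⟦⟧-samePattern φ (samePattern-sym same) φw)
⟦⟧-samePattern (conj φ ψ) same (φz , ψz) =
  ⟦⟧-samePattern φ (Allₚ.++⁻ˡ (atoms φ) same) φz , ⟦⟧-samePattern ψ (Allₚ.++⁻ʳ (atoms φ) same) ψz
⟦⟧-samePattern (disj φ ψ) same =
  Sum.map (⟦⟧-samePattern φ (Allₚ.++⁻ˡ (atoms φ) same)) (⟦⟧-samePattern ψ (Allₚ.++⁻ʳ (atoms φ) same))

samePattern-segment : ∀ {d} (L : List (Atom d)) (p r : Vec ℤ d) i j →
  SamePattern L p (p +ᵛ + suc (i ℕ.+ j) ·ᵛ r) → SamePattern L p (p +ᵛ + i ·ᵛ r)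
samePattern-segment L p r i j = All.map λ { {a , b} ends →
  trans (≤?-between (dot a p) (dot a r) b i j (trans ends (onLine a b (+ suc (i ℕ.+ j)))))
        (sym (onLine a b (+ i))) }
  where
  onLine : ∀ a b c → holds (a , b) (p +ᵛ c ·ᵛ r) ≡ does (dot a p + c * dot a r ≤? b)
  onLine a b c = cong (λ x → does (x ≤? b)) (dot-line a p r c)

residues : ∀ {d} K .{{_ : NonZero K}} → Vec ℤ d → Fin (K ^ d)
residues K [] = Fin.zero
residues K (x ∷ z) = combine (fromℕ< (n%ℕd<d x K)) (residues K z)

%ℕ-≡⇒shift : ∀ (x y : ℤ) K .{{_ : NonZero K}} → x %ℕ K ≡ y %ℕ K → y ≡ x + + K * (y /ℕ K - x /ℕ K)
%ℕ-≡⇒shift x y K same = begin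
  y                                                         ≡⟨ a≡a%ℕn+[a/ℕn]*n y K ⟩
  + (y %ℕ K) + y /ℕ K * + K                                 ≡⟨ cong (λ ρ → + ρ + y /ℕ K * + K) (sym same) ⟩
  + (x %ℕ K) + y /ℕ K * + K                                 ≡⟨ regroup (+ (x %ℕ K)) (x /ℕ K) (y /ℕ K) (+ K) ⟩
  + (x %ℕ K) + x /ℕ K * + K + + K * (y /ℕ K - x /ℕ K)       ≡⟨ cong (_+ + K * (y /ℕ K - x /ℕ K)) (a≡a%ℕn+[a/ℕn]*n x K) ⟨
  x + + K * (y /ℕ K - x /ℕ K)                               ∎
  where
  open ≡-Reasoning
  regroup : ∀ ρ q q' k → ρ + q' * k ≡ ρ + q * k + k * (q' - q)
  regroup = solve-∀

residues-≡⇒shift : ∀ {d} K .{{_ : NonZero K}} (z w : Vec ℤ d) →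
  residues K z ≡ residues K w → Σ (Vec ℤ d) λ r → w ≡ z +ᵛ + K ·ᵛ r
residues-≡⇒shift K [] [] _ = [] , refl
residues-≡⇒shift K (x ∷ z) (y ∷ w) same
  with headSame , tailSame ← Finₚ.combine-injective _ (residues K z) _ (residues K w) same
  with r , w≡ ← residues-≡⇒shift K z w tailSame =
  y /ℕ K - x /ℕ K ∷ r ,
  cong₂ _∷_ (%ℕ-≡⇒shift x y K (Finₚ.fromℕ<-injective _ _ (n%ℕd<d x K) (n%ℕd<d y K) headSame)) w≡

count : ∀ {X : Set} → (X → Bool) → List X → ℕ
count v [] = 0
count v (x ∷ xs) = if v x then suc (count v xs) else count v xs

count≤length : ∀ {X : Set} (v : X → Bool) xs → count v xs ℕ.≤ length xs
count≤length v [] = z≤n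
count≤length v (x ∷ xs) with v x
... | true = s≤s (count≤length v xs)
... | false = ℕₚ.m≤n⇒m≤1+n (count≤length v xs)

Included : ∀ {X : Set} → (X → Bool) → (X → Bool) → List X → Set
Included v w xs = All (λ x → v x ≡ true → w x ≡ true) xs

count-mono : ∀ {X : Set} (v w : X → Bool) xs → Included v w xs → count v xs ℕ.≤ count w xs
count-mono v w [] [] = z≤n
count-mono v w (x ∷ xs) (v⇒w ∷ inc) with v x | w x | v⇒w
... | true | true | _ = s≤s (count-mono v w xs inc)
... | true | false | v⇒w′ with () ← v⇒w′ refl
... | false | true | _ = ℕₚ.m≤n⇒m≤1+n (count-mono v w xs inc)
... | false | false | _ = count-mono v w xs inc

included-count-≡⇒≗ : ∀ {X : Set} (v w : X → Bool) xs → Included v w xs →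
  count v xs ≡ count w xs → All (λ x → v x ≡ w x) xs
included-count-≡⇒≗ v w [] [] _ = []
included-count-≡⇒≗ v w (x ∷ xs) (v⇒w ∷ inc) eq with v x in vx | w x in wx | v⇒w
... | true | true | _ = trans vx (sym wx) ∷ included-count-≡⇒≗ v w xs inc (ℕₚ.suc-injective eq)
... | false | false | _ = trans vx (sym wx) ∷ included-count-≡⇒≗ v w xs inc eq
... | true | false | v⇒w′ with () ← v⇒w′ refl
... | false | true | _ = contradiction eq (ℕₚ.<⇒≢ (s≤s (count-mono v w xs inc)))

included-or-separated : ∀ {X : Set} (v w : X → Bool) xs →
  Included v w xs ⊎ Σ X λ x → x ∈ xs × v x ≡ true × w x ≡ false
included-or-separated v w [] = inj₁ []
included-or-separated v w (x ∷ xs) with v x in vx | w x in wx | included-or-separated v w xs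
... | true | false | _ = inj₂ (x , here refl , vx , wx)
... | _ | _ | inj₂ (y , y∈xs , vy , wy) = inj₂ (y , there y∈xs , vy , wy)
... | true | true | inj₁ inc = inj₁ ((λ _ → wx) ∷ inc)
... | false | _ | inj₁ inc = inj₁ ((λ vx′ → contradiction (trans (sym vx) vx′) λ ()) ∷ inc)

-- The exchange hypothesis makes the sets accepted by v and w nested.
count-≡⇒≗ : ∀ {X : Set} (v w : X → Bool) xs →
  (∀ {x y} → x ∈ xs → y ∈ xs → v x ≡ true → w x ≡ false → w y ≡ true → v y ≡ true) →
  count v xs ≡ count w xs → All (λ x → v x ≡ w x) xs
count-≡⇒≗ v w xs exchange eq with included-or-separated v w xs
... | inj₁ inc = included-count-≡⇒≗ v w xs inc eq
... | inj₂ (x , x∈xs , vx , wx) =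
  All.map sym (included-count-≡⇒≗ w v xs (All.tabulate λ y∈xs → exchange x∈xs y∈xs vx wx) (sym eq))

UpperBound : ℕ → Set
UpperBound d = ℕ × Vec ℤ d × ℤ

boundHolds : ∀ {d} → UpperBound d → ℤ → Vec ℤ d → Bool
boundHolds (n , a , b) t z = does (+[1+ n ] * t + dot a z ≤? b)

-- compareBounds p q holds at z iff θ_q(z) ≤ θ_p(z), where θ_(n,a,b)(z) is the
-- bound (b − a · z) / (1 + n) on t.
compareBounds : ∀ {d} → UpperBound d → UpperBound d → Atom d
compareBounds (n , a , b) (n' , a' , b') = +[1+ n' ] ·ᵛ a +ᵛ -[1+ n ] ·ᵛ a' , +[1+ n' ] * b + -[1+ n ] * b'

dot-compareBounds : ∀ {d} n a b n' a' b' (z : Vec ℤ d) →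
  dot (proj₁ (compareBounds (n , a , b) (n' , a' , b'))) z ≡ +[1+ n' ] * dot a z + -[1+ n ] * dot a' z
dot-compareBounds n a b n' a' b' z =
  trans (dot-+ᵛˡ (+[1+ n' ] ·ᵛ a) (-[1+ n ] ·ᵛ a') z)
        (cong₂ _+_ (dot-·ᵛˡ +[1+ n' ] a z) (dot-·ᵛˡ -[1+ n ] a' z))

-- θ_p(w) < s ≤ θ_q(w), so the comparison fails at w, hence at z, where
-- t ≤ θ_p(z) < θ_q(z).
bound-exchange : ∀ {d} (p q : UpperBound d) {t s z w} →
  holds (compareBounds p q) z ≡ holds (compareBounds p q) w →
  boundHolds p t z ≡ true → boundHolds p s w ≡ false → boundHolds q s w ≡ true → boundHolds q t z ≡ true
bound-exchange (n , a , b) (n' , a' , b') {t} {s} {z} {w} agree p-tz ¬p-sw q-sw =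
  dec-true (+[1+ n' ] * t + dot a' z ≤? b') (ℤₚ.≮⇒≥ λ b'<q-tz →
    nonneg-combination≢neg (suc n') (suc n) 1 (does-true⁻ (+[1+ n ] * t + dot a z ≤? b) p-tz) (ℤₚ.i<j⇒suc[i]≤j b'<q-tz)
      (ℤₚ.i<j⇒suc[i]≤j (ℤₚ.≰⇒> ¬comparison-z)) (certificate-z (+ n) (+ n') t (dot a z) (dot a' z) b b'))
  where
  C = compareBounds (n , a , b) (n' , a' , b')
  ¬comparison-w : ¬ (dot (proj₁ C) w ≤ proj₂ C)
  ¬comparison-w comparison =
    nonneg-combination≢neg (suc n') (suc n) 1
      (ℤₚ.i<j⇒suc[i]≤j (ℤₚ.≰⇒> (does-false⁻ (+[1+ n ] * s + dot a w ≤? b) ¬p-sw)))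
      (does-true⁻ (+[1+ n' ] * s + dot a' w ≤? b') q-sw)
      (subst (_≤ proj₂ C) (dot-compareBounds n a b n' a' b' w) comparison)
      (certificate-w (+ n) (+ n') s (dot a w) (dot a' w) b b')
    where
    certificate-w : ∀ N N' s A A' b b' →
      (+ 1 + N') * ((+ 1 + N) * s + A - (+ 1 + b)) + (+ 1 + N) * (b' - ((+ 1 + N') * s + A'))
        + + 1 * ((+ 1 + N') * b + - (+ 1 + N) * b' - ((+ 1 + N') * A + - (+ 1 + N) * A'))
        ≡ - (+ 1 + N')
    certificate-w = solve-∀
  ¬comparison-z : ¬ (+[1+ n' ] * dot a z + -[1+ n ] * dot a' z ≤ proj₂ C)
  ¬comparison-z = does-false⁻ (_ ≤? proj₂ C)
    (trans (cong (λ x → does (x ≤? proj₂ C)) (sym (dot-compareBounds n a b n' a' b' z)))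
           (trans agree (dec-false (_ ≤? proj₂ C) ¬comparison-w)))
  certificate-z : ∀ N N' t A A' b b' →
    (+ 1 + N') * (b - ((+ 1 + N) * t + A)) + (+ 1 + N) * ((+ 1 + N') * t + A' - (+ 1 + b'))
      + + 1 * ((+ 1 + N') * A + - (+ 1 + N) * A' - (+ 1 + ((+ 1 + N') * b + - (+ 1 + N) * b')))
      ≡ - (+ 1 + (+ 1 + N))
  certificate-z = solve-∀

tFree : ∀ {d} → Atom (suc d) → Atom d
tFree (_ ∷ a , b) = a , b

-- c t + a · z ≤ b with c < 0 is the negation of ∣c∣ t − a · z ≤ − b − 1.  For
-- c = 0 the bound is junk and never consulted.
asBound : ∀ {d} → Atom (suc d) → UpperBound d
asBound (+ zero ∷ a , b) = 0 , a , b
asBound (+[1+ n ] ∷ a , b) = n , a , b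
asBound (-[1+ n ] ∷ a , b) = n , -[1+ 0 ] ·ᵛ a , - b - + 1

holds-determined : ∀ {d} (A : Atom (suc d)) {t s z w} →
  holds (tFree A) z ≡ holds (tFree A) w → boundHolds (asBound A) t z ≡ boundHolds (asBound A) s w →
  holds A (t ∷ z) ≡ holds A (s ∷ w)
holds-determined (+ zero ∷ a , b) {t} {s} {z} {w} same _ =
  trans (dropsOut t z) (trans same (sym (dropsOut s w)))
  where
  dropsOut : ∀ t z → holds (+ 0 ∷ a , b) (t ∷ z) ≡ holds (a , b) z
  dropsOut t z = cong (λ x → does (x ≤? b)) (ℤₚ.+-identityˡ (dot a z))
holds-determined (+[1+ n ] ∷ a , b) _ same = same
holds-determined (-[1+ n ] ∷ a , b) {t} {s} {z} {w} _ same =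
  trans (negated t z) (trans (cong not same) (sym (negated s w)))
  where
  negated : ∀ t z → holds (-[1+ n ] ∷ a , b) (t ∷ z) ≡ not (boundHolds (asBound (-[1+ n ] ∷ a , b)) t z)
  negated t z = trans (≤?-flip (-[1+ n ] * t + dot a z) b)
    (cong (λ x → not (does (x ≤? - b - + 1)))
          (trans (distribute (+ n) t (dot a z)) (cong (λ D → +[1+ n ] * t + D) (sym (dot-·ᵛˡ -[1+ 0 ] a z)))))
    where
    distribute : ∀ N t D → - (- (+ 1 + N) * t + D) ≡ (+ 1 + N) * t + - + 1 * D
    distribute = solve-∀

eliminate : ∀ {d} → List (Atom (suc d)) → List (Atom d)
eliminate L =
  List.map tFree L ++ cartesianProductWith (λ A B → compareBounds (asBound A) (asBound B)) L L

length-cartesianProductWith : ∀ {A B C : Set} (f : A → B → C) xs ys →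
  length (cartesianProductWith f xs ys) ≡ length xs ℕ.* length ys
length-cartesianProductWith f [] ys = refl
length-cartesianProductWith f (x ∷ xs) ys =
  trans (Listₚ.length-++ (List.map (f x) ys))
        (cong₂ ℕ._+_ (Listₚ.length-map (f x) ys) (length-cartesianProductWith f xs ys))

suc-length-eliminate≤ : ∀ {d} (L : List (Atom (suc d))) → suc (length (eliminate L)) ℕ.≤ suc (length L) ^ 2
suc-length-eliminate≤ L = begin
  suc (length (eliminate L))  ≡⟨ cong suc (Listₚ.length-++ (List.map tFree L)) ⟩
  suc (length (List.map tFree L) ℕ.+ _)
    ≡⟨ cong₂ (λ x y → suc (x ℕ.+ y)) (Listₚ.length-map tFree L) (length-cartesianProductWith _ L L) ⟩
  suc (m ℕ.+ m ℕ.* m)         ≤⟨ ℕₚ.m≤m+n _ m ⟩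
  suc (m ℕ.+ m ℕ.* m) ℕ.+ m   ≡⟨ square m ⟩
  suc m ^ 2                   ∎
  where
  open ℕₚ.≤-Reasoning
  m = length L
  square : ∀ m → suc (m ℕ.+ m ℕ.* m) ℕ.+ m ≡ suc m ℕ.* (suc m ℕ.* 1)
  square = ℕ-Solver.solve-∀

samePattern-eliminate : ∀ {d} (L : List (Atom (suc d))) {t s z w} → SamePattern (eliminate L) z w →
  count (λ A → boundHolds (asBound A) t z) L ≡ count (λ A → boundHolds (asBound A) s w) L →
  SamePattern L (t ∷ z) (s ∷ w)
samePattern-eliminate L {t} {s} {z} {w} same sameCount =
  All.zipWith (λ { {A} (free , bound) → holds-determined A free bound }) (tFreeSame , boundsSame)
  where
  tFreeSame : All (λ A → holds (tFree A) z ≡ holds (tFree A) w) L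
  tFreeSame = Allₚ.map⁻ (Allₚ.++⁻ˡ (List.map tFree L) same)
  comparisonSame : ∀ {A B} → A ∈ L → B ∈ L →
    holds (compareBounds (asBound A) (asBound B)) z ≡ holds (compareBounds (asBound A) (asBound B)) w
  comparisonSame A∈L B∈L =
    All.lookup (Allₚ.++⁻ʳ (List.map tFree L) same) (∈-cartesianProductWith⁺ _ A∈L B∈L)
  boundsSame : All (λ A → boundHolds (asBound A) t z ≡ boundHolds (asBound A) s w) L
  boundsSame = count-≡⇒≗ (λ A → boundHolds (asBound A) t z) (λ A → boundHolds (asBound A) s w) L
    (λ {A} {B} A∈L B∈L → bound-exchange (asBound A) (asBound B) {t} {s} {z} {w} (comparisonSame A∈L B∈L)) sameCount

record PatternCode (d : ℕ) (L : List (Atom d)) (E : ℕ) : Set where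
  field
    size : ℕ
    size≤ : size ℕ.≤ suc (length L) ^ E
    code : Vec ℤ d → Fin size
    code-≡⇒samePattern : ∀ z w → code z ≡ code w → SamePattern L z w

patternCode-step : ∀ {d E} (L : List (Atom (suc d))) → PatternCode d (eliminate L) E →
  PatternCode (suc d) L (suc (2 ℕ.* E))
patternCode-step {d} {E} L C = record
  { size = suc (length L) ℕ.* C.size
  ; size≤ = ℕₚ.*-monoʳ-≤ (suc (length L)) (begin
      C.size                                ≤⟨ C.size≤ ⟩
      suc (length (eliminate L)) ^ E        ≤⟨ ℕₚ.^-monoˡ-≤ E (suc-length-eliminate≤ L) ⟩
      (suc (length L) ^ 2) ^ E              ≡⟨ ℕₚ.^-*-assoc (suc (length L)) 2 E ⟩
      suc (length L) ^ (2 ℕ.* E)            ∎)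
  ; code = code
  ; code-≡⇒samePattern = λ { (t ∷ z) (s ∷ w) same →
      let boundCount , tail = Finₚ.combine-injective _ (C.code z) _ (C.code w) same
      in samePattern-eliminate L (C.code-≡⇒samePattern z w tail)
           (Finₚ.fromℕ<-injective _ _ (s≤s (count≤length _ L)) (s≤s (count≤length _ L)) boundCount) }
  }
  where
  module C = PatternCode C
  open ℕₚ.≤-Reasoning
  code : Vec ℤ (suc d) → Fin (suc (length L) ℕ.* C.size)
  code (t ∷ z) = combine (fromℕ< (s≤s (count≤length (λ A → boundHolds (asBound A) t z) L))) (C.code z)

patternExponent : ℕ → ℕ
patternExponent zero = 0
patternExponent (suc d) = suc (2 ℕ.* patternExponent d)

patternCode : ∀ d (L : List (Atom d)) → PatternCode d L (patternExponent d)
patternCode zero L = record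
  { size = 1
  ; size≤ = s≤s z≤n
  ; code = λ _ → Fin.zero
  ; code-≡⇒samePattern = λ { [] [] _ → All.universal (λ _ → refl) L }
  }
patternCode (suc d) L = patternCode-step L (patternCode d (eliminate L))

unique-lookup-distinct : ∀ {A : Set} {xs : List A} → Unique xs → ∀ i j → i Fin.< j →
  List.lookup xs i ≢ List.lookup xs j
unique-lookup-distinct (x≢ ∷ _) Fin.zero (Fin.suc j) _ = All.lookup x≢ (∈-lookup j)
unique-lookup-distinct (_ ∷ unique) (Fin.suc i) (Fin.suc j) (s≤s i<j) = unique-lookup-distinct unique i j i<j

collision : ∀ {A : Set} {P : A → Set} {m} {xs : List A} → Unique xs → All P xs →
  (f : ∀ {x} → P x → Fin m) → m ℕ.< length xs →
  Σ A λ x → Σ A λ y → x ≢ y × Σ (P x) λ px → Σ (P y) λ py → f px ≡ f py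
collision {xs = xs} unique ps f m<length
  with i , j , i<j , same ← Finₚ.pigeonhole m<length (λ i → f (All.lookup ps (∈-lookup i))) =
  List.lookup xs i , List.lookup xs j , unique-lookup-distinct unique i j i<j , _ , _ , same

segment⇒HasAP : ∀ {n} (Φ : Formula (suc n)) k x (y : Vec ℤ n) r₀ (r : Vec ℤ n) → r₀ ≢ + 0 →
  SamePattern (atoms Φ) (x ∷ y) ((x ∷ y) +ᵛ + suc k ·ᵛ (r₀ ∷ r)) → ⟦ Φ ⟧ (x ∷ y) → HasAP (suc k) (InS Φ)
segment⇒HasAP Φ k x y r₀ r r₀≢0 same Φxy = x , r₀ , r₀≢0 , term
  where
  term : ∀ i → i ℕ.< suc k → InS Φ (x + + i * r₀)
  term i (s≤s i≤k) = _ , ⟦⟧-samePattern Φ (samePattern-segment (atoms Φ) (x ∷ y) (r₀ ∷ r) i (k ℕ.∸ i)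
    (subst (λ N → SamePattern (atoms Φ) (x ∷ y) ((x ∷ y) +ᵛ + N ·ᵛ (r₀ ∷ r)))
           (sym (cong suc (ℕₚ.m+[n∸m]≡n i≤k))) same)) Φxy

module _ {n} (Φ : Formula (suc n)) {E} (C : PatternCode (suc n) (atoms Φ) E) (k : ℕ) where
  open PatternCode C

  private
    K = suc k

  colour : ∀ {x} → InS Φ x → Fin (size ℕ.* K ^ suc n)
  colour {x} (y , _) = combine (code (x ∷ y)) (residues K (x ∷ y))

  many-solutions⇒HasAP : AtLeast (InS Φ) (suc (size ℕ.* K ^ suc n)) → HasAP K (InS Φ)
  many-solutions⇒HasAP (xs , unique , inS , many)
    with x , x' , x≢x' , (y , Φxy) , _ , same ← collision unique inS colour many
    with sameCode , sameResidues ← Finₚ.combine-injective _ (residues K (x ∷ y)) _ _ same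
    with r₀ ∷ r , x'y'≡ ← residues-≡⇒shift K (x ∷ y) (x' ∷ _) sameResidues =
    segment⇒HasAP Φ k x y r₀ r r₀≢0
      (subst (SamePattern (atoms Φ) (x ∷ y)) x'y'≡ (code-≡⇒samePattern _ _ sameCode)) Φxy
    where
    r₀≢0 : r₀ ≢ + 0
    r₀≢0 r₀≡0 = x≢x' (sym (begin
      x'                 ≡⟨ cong Vec.head x'y'≡ ⟩
      x + + K * r₀       ≡⟨ cong (λ c → x + + K * c) r₀≡0 ⟩
      x + + K * + 0      ≡⟨ cong (λ D → x + D) (ℤₚ.*-zeroʳ (+ K)) ⟩
      x + + 0            ≡⟨ ℤₚ.+-identityʳ x ⟩
      x                  ∎))
      where open ≡-Reasoning

suc-length-atoms≤ℓ : ∀ {m} (Φ : Formula m) → suc (length (atoms Φ)) ℕ.≤ ℓ Φ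
suc-length-atoms≤ℓ (atom a b) = ℕₚ.≤-trans (s≤s (s≤s z≤n)) (ℕₚ.m≤n+m _ _)
suc-length-atoms≤ℓ (neg φ) = ℕₚ.m≤n⇒m≤1+n (suc-length-atoms≤ℓ φ)
suc-length-atoms≤ℓ (conj φ ψ) = s≤s (ℕₚ.≤-trans (ℕₚ.≤-reflexive (Listₚ.length-++ (atoms φ)))
  (ℕₚ.+-mono-≤ (ℕₚ.<⇒≤ (suc-length-atoms≤ℓ φ)) (ℕₚ.<⇒≤ (suc-length-atoms≤ℓ ψ))))
suc-length-atoms≤ℓ (disj φ ψ) = s≤s (ℕₚ.≤-trans (ℕₚ.≤-reflexive (Listₚ.length-++ (atoms φ)))
  (ℕₚ.+-mono-≤ (ℕₚ.<⇒≤ (suc-length-atoms≤ℓ φ)) (ℕₚ.<⇒≤ (suc-length-atoms≤ℓ ψ))))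

patternCode-size≤ℓ^ : ∀ {m E} (Φ : Formula m) (C : PatternCode m (atoms Φ) E) →
  PatternCode.size C ℕ.≤ ℓ Φ ^ E
patternCode-size≤ℓ^ {E = E} Φ C = ℕₚ.≤-trans (PatternCode.size≤ C) (ℕₚ.^-monoˡ-≤ E (suc-length-atoms≤ℓ Φ))

monomial : ℕ → ℕ → Poly
monomial zero c = c ∷ []
monomial (suc e) c = 0 ∷ monomial e c

evalPoly-monomial : ∀ e c t → evalPoly (monomial e c) t ≡ t ^ e ℕ.* c
evalPoly-monomial zero c t = cong (c ℕ.+_) (ℕₚ.*-zeroʳ t)
evalPoly-monomial (suc e) c t =
  trans (cong (t ℕ.*_) (evalPoly-monomial e c t)) (sym (ℕₚ.*-assoc t (t ^ e) c))

AtLeast-weaken : ∀ {S : ℤ → Set} {M N} → M ℕ.≤ N → AtLeast S N → AtLeast S M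
AtLeast-weaken M≤N (xs , unique , inS , N≤) = xs , unique , inS , ℕₚ.≤-trans M≤N N≤

theorem9p5 : (n k : ℕ) → 1 ℕ.≤ n → 1 ℕ.≤ k →
    Σ Poly λ P → (Φ : Formula (suc n)) →
      AtLeast (InS Φ) (evalPoly P (ℓ Φ)) → HasAP k (InS Φ)
theorem9p5 n (suc k) _ _ = 1 ∷ monomial (2 ℕ.* E) c , λ Φ many →
  many-solutions⇒HasAP Φ (patternCode (suc n) (atoms Φ)) k (AtLeast-weaken (s≤s (enough Φ)) many)
  where
  E = patternExponent n
  c = suc k ^ suc n
  enough : ∀ Φ → PatternCode.size (patternCode (suc n) (atoms Φ)) ℕ.* c
                   ℕ.≤ evalPoly (monomial (suc (2 ℕ.* E)) c) (ℓ Φ)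
  enough Φ = ℕₚ.≤-trans (ℕₚ.*-monoˡ-≤ c (patternCode-size≤ℓ^ Φ (patternCode (suc n) (atoms Φ))))
                        (ℕₚ.≤-reflexive (sym (evalPoly-monomial (suc (2 ℕ.* E)) c (ℓ Φ))))
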